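{- Let $k\ge1$ and $m\ge0$ be integers. Then the Narayana number $N_{k-1,m}$ equals the number of cyclic compositions of $2k-1$ into $k$ parts such that exactly $m$ parts are at least $2$.
   Context: A composition of $n$ into $k$ parts is a sequence of $k$ positive integers summing to $n$; a cyclic composition is an equivalence class of compositions under cyclic shift. The Narayana numbers are $N_{n,j}=\frac{1}{n}\binom{n}{j}\binom{n}{j-1}$ for $n\ge1$, $j\ge0$ (so $N_{n,j}=0$ unless $1\le j\le n$), and $N_{0,0}=1$, $N_{0,j}=0$ for $j\ge1$. -}

module Defs where

open import Data.Nat using (ℕ; zero; suc; _+_; _*_; _∸_; _/_; _≤_; _≤ᵇ_)
open import Data.Nat.Combinatorics using (_C_)
open import Data.Vec using (Vec; []; _∷_; _∷ʳ_; sum; count)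
open import Data.Vec.Relation.Unary.All using (All)
open import Data.List using (List; length)
open import Data.List.Membership.Propositional using (_∈_)
open import Data.List.Relation.Unary.All as LAll using ()
open import Data.List.Relation.Unary.AllPairs using (AllPairs)
open import Data.Product using (Σ; ∃; ∃-syntax; _×_)
open import Relation.Binary.PropositionalEquality using (_≡_)
open import Relation.Nullary using (¬_)
open import Relation.Nullary.Decidable using (Dec)
open import Data.Nat.Properties using (_≤?_)

-- Narayana numbers: N 0 0 = 1, N 0 j = 0 (j ≥ 1),
-- N n j = (1/n) C(n,j) C(n,j-1) for n ≥ 1 (C(n,-1) = 0, so N n 0 = 0).
narayana : ℕ → ℕ → ℕ
narayana zero zero = 1
narayana zero (suc j) = 0
narayana (suc n) zero = 0
narayana (suc n) (suc j) = ((suc n C suc j) * (suc n C j)) / suc n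

IsComposition : (n k : ℕ) → Vec ℕ k → Set
IsComposition n k v = All (λ x → 1 ≤ x) v × sum v ≡ n

rotate : ∀ {k} → Vec ℕ k → Vec ℕ k
rotate [] = []
rotate (x ∷ xs) = xs ∷ʳ x

rotateN : ∀ {k} → ℕ → Vec ℕ k → Vec ℕ k
rotateN zero v = v
rotateN (suc i) v = rotate (rotateN i v)

CycEquiv : ∀ {k} → Vec ℕ k → Vec ℕ k → Set
CycEquiv v w = ∃[ i ] rotateN i v ≡ w

bigParts : ∀ {k} → Vec ℕ k → ℕ
bigParts v = count (λ x → 2 ≤? x) v

Good : (k m : ℕ) → Vec ℕ k → Set
Good k m v = IsComposition (2 * k ∸ 1) k v × bigParts v ≡ m

-- "The number of cyclic compositions satisfying P is c":
-- there is a complete system of representatives of the cyclic-equivalence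
-- classes of P-compositions, of length c.
NumCyclicClasses : (k : ℕ) → (Vec ℕ k → Set) → ℕ → Set
NumCyclicClasses k P c =
  Σ (List (Vec ℕ k)) λ reps →
      LAll.All P reps
    × AllPairs (λ v w → ¬ CycEquiv v w) reps
    × (∀ v → P v → ∃[ w ] (w ∈ reps × CycEquiv v w))
    × length reps ≡ c

-- Rotation acts freely on the compositions of 2k − 1 into k parts with m parts ≥ 2, and by the cycle
-- lemma each orbit contains exactly one composition whose prefixes of length j < k all sum to at least
-- 2j: the prefix sums minus 2j form a walk that drops by one per period, and the rotation starting at
-- its first minimum is the only one that never goes below its starting level. The compositions
-- themselves are counted by choosing the m positions of the large parts and a composition of the
-- excess k − 1 into m parts, which gives C(k,m) C(k−2,m−1) of them and hence
-- C(k,m) C(k−2,m−1) / k = N(k−1,m) orbits.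

module Submission where

open import Defs
open import Data.Bool using (true; false)
open import Data.List
  using (List; []; _∷_; _++_; [_]; take; drop; length; map; applyUpTo; concatMap; filter)
open import Data.List.Membership.Propositional using (_∈_; find; lose)
open import Data.List.Membership.Propositional.Properties
  using (∈-map⁺; ∈-map⁻; ∈-++⁺ˡ; ∈-++⁺ʳ; ∈-++⁻; ∈-applyUpTo⁺; ∈-applyUpTo⁻; ∈-concatMap⁺; ∈-concatMap⁻;
         ∈-filter⁺; ∈-filter⁻)
open import Data.List.Membership.Propositional.Properties.WithK using (unique∧set⇒bag)
open import Data.List.Properties
  using (++-identityʳ; ++-assoc; take-[]; take-take; take-all; drop-all; length-drop; length-++; length-map;
         length-applyUpTo)
open import Data.List.Relation.Binary.BagAndSetEquality using (∼bag⇒↭)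
open import Data.List.Relation.Binary.Disjoint.Propositional using (Disjoint)
open import Data.List.Relation.Binary.Permutation.Propositional using (_↭_)
open import Data.List.Relation.Binary.Permutation.Propositional.Properties using (↭-length)
open import Data.List.Relation.Unary.All as ListAll using ([]; _∷_)
import Data.List.Relation.Unary.All.Properties as ListAll
open import Data.List.Relation.Unary.AllPairs as AllPairs using (AllPairs; []; _∷_)
import Data.List.Relation.Unary.AllPairs.Properties as AllPairs
open import Data.List.Relation.Unary.Any using (here)
open import Data.List.Relation.Unary.Unique.Propositional using (Unique)
import Data.List.Relation.Unary.Unique.Propositional.Properties as Unique
open import Data.Nat
open import Data.Nat.Combinatorics using (_C_; nCk+nC[k+1]≡[n+1]C[k+1]; k>n⇒nCk≡0; nC1≡n)
open import Data.Nat.DivMod using (m*n/n≡m; m≡m%n+[m/n]*n; m%n<n)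
open import Data.Nat.ListAction using (sum)
open import Data.Nat.ListAction.Properties using (sum-++)
open import Data.Nat.Properties
open import Algebra.Properties.CommutativeSemigroup *-commutativeSemigroup using (x∙yz≈y∙xz)
open import Data.Nat.Tactic.RingSolver using (solve-∀)
open import Data.Product using (∃-syntax; _×_; _,_; proj₁)
open import Data.Sum using (inj₁; inj₂)
open import Data.Vec as Vec using (Vec; []; _∷_; _∷ʳ_; toList; count)
open import Data.Vec.Properties using (∷-injectiveʳ; toList-∷ʳ; length-toList; toList-injective; cast-is-id)
open import Data.Vec.Relation.Unary.All using (All; []; _∷_)
open import Function using (_∘_)
open import Function.Bundles using (mk⇔)
open import Relation.Binary.PropositionalEquality hiding ([_])
open import Relation.Nullary using (¬_; does; yes; no; contradiction)
open import Relation.Unary using (Pred; Decidable)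

-- Binomial identities

compositionCount : ℕ → ℕ → ℕ
compositionCount zero    zero    = 1
compositionCount zero    (suc j) = 0
compositionCount (suc s) zero    = 0
compositionCount (suc s) (suc j) = compositionCount s j + compositionCount s (suc j)

compositionCount-suc : ∀ s j → compositionCount (suc s) (suc j) ≡ s C j
compositionCount-suc zero    zero    = refl
compositionCount-suc zero    (suc j) = sym (k>n⇒nCk≡0 {0} {suc j} z<s)
compositionCount-suc (suc s) zero    = compositionCount-suc s zero
compositionCount-suc (suc s) (suc j) =
  trans (cong₂ _+_ (compositionCount-suc s j) (compositionCount-suc s (suc j)))
        (nCk+nC[k+1]≡[n+1]C[k+1] s j)

[k+1]*[n+1]C[k+1]≡[n+1]*nCk : ∀ n k → suc k * (suc n C suc k) ≡ suc n * (n C k)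
[k+1]*[n+1]C[k+1]≡[n+1]*nCk zero    zero    = refl
[k+1]*[n+1]C[k+1]≡[n+1]*nCk zero    (suc k) = begin
  suc (suc k) * (1 C suc (suc k)) ≡⟨ cong (suc (suc k) *_) (k>n⇒nCk≡0 {1} {suc (suc k)} (s<s z<s)) ⟩
  suc (suc k) * 0                 ≡⟨ *-zeroʳ (suc (suc k)) ⟩
  0                               ≡⟨ cong (1 *_) (k>n⇒nCk≡0 {0} {suc k} z<s) ⟨
  1 * (0 C suc k)                 ∎
  where open ≡-Reasoning
[k+1]*[n+1]C[k+1]≡[n+1]*nCk (suc n) zero    =
  trans (*-identityˡ _) (trans (nC1≡n (suc (suc n))) (sym (*-identityʳ (suc (suc n)))))
[k+1]*[n+1]C[k+1]≡[n+1]*nCk (suc n) (suc k) = begin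
  suc (suc k) * (suc (suc n) C suc (suc k))
    ≡⟨ cong (suc (suc k) *_) (nCk+nC[k+1]≡[n+1]C[k+1] (suc n) (suc k)) ⟨
  suc (suc k) * (a + b)
    ≡⟨ regroup a b k ⟩
  a + suc k * a + suc (suc k) * b
    ≡⟨ cong₂ (λ x y → a + x + y) ([k+1]*[n+1]C[k+1]≡[n+1]*nCk n k)
                                  ([k+1]*[n+1]C[k+1]≡[n+1]*nCk n (suc k)) ⟩
  a + suc n * (n C k) + suc n * (n C suc k)
    ≡⟨ factor a (suc n) (n C k) (n C suc k) ⟩
  a + suc n * (n C k + n C suc k)
    ≡⟨ cong (λ x → a + suc n * x) (nCk+nC[k+1]≡[n+1]C[k+1] n k) ⟩
  suc (suc n) * a ∎
  where
  open ≡-Reasoning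
  a : ℕ
  a = suc n C suc k
  b : ℕ
  b = suc n C suc (suc k)
  regroup : ∀ a b k → (2 + k) * (a + b) ≡ a + (1 + k) * a + (2 + k) * b
  regroup = solve-∀
  factor : ∀ a m x y → a + m * x + m * y ≡ a + m * (x + y)
  factor = solve-∀

narayana-unique : ∀ k m N → suc k * N ≡ (suc k C m) * compositionCount k m → N ≡ narayana k m
narayana-unique zero    zero    N eq = trans (sym (*-identityˡ N)) eq
narayana-unique zero    (suc m) N eq = *-cancelˡ-≡ N 0 1 (trans eq (*-zeroʳ (1 C suc m)))
narayana-unique (suc t) zero    N eq =
  *-cancelˡ-≡ N 0 (2 + t) (trans eq (trans (*-zeroʳ (suc (suc t) C 0)) (sym (*-zeroʳ (2 + t)))))
narayana-unique (suc t) (suc j) N eq = begin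
  N                 ≡⟨ m*n/n≡m N (suc t) ⟨
  N * suc t / suc t ≡⟨ cong (_/ suc t) (trans (*-comm N (suc t)) [t+1]*N) ⟩
  a * b / suc t     ∎
  where
  open ≡-Reasoning
  a′ : ℕ
  a′ = suc (suc t) C suc j
  a : ℕ
  a = suc t C suc j
  b : ℕ
  b = suc t C j
  c : ℕ
  c = t C j
  [j+1]*N : suc j * N ≡ b * c
  [j+1]*N = *-cancelˡ-≡ _ _ (2 + t) (begin
    (2 + t) * (suc j * N)  ≡⟨ x∙yz≈y∙xz (2 + t) (suc j) N ⟩
    suc j * ((2 + t) * N)  ≡⟨ cong (suc j *_) (trans eq (cong (a′ *_) (compositionCount-suc t j))) ⟩
    suc j * (a′ * c)       ≡⟨ *-assoc (suc j) a′ c ⟨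
    suc j * a′ * c         ≡⟨ cong (_* c) ([k+1]*[n+1]C[k+1]≡[n+1]*nCk (suc t) j) ⟩
    (2 + t) * b * c        ≡⟨ *-assoc (2 + t) b c ⟩
    (2 + t) * (b * c)      ∎)
  [t+1]*N : suc t * N ≡ a * b
  [t+1]*N = *-cancelˡ-≡ _ _ (suc j) (begin
    suc j * (suc t * N)   ≡⟨ x∙yz≈y∙xz (suc j) (suc t) N ⟩
    suc t * (suc j * N)   ≡⟨ cong (suc t *_) [j+1]*N ⟩
    suc t * (b * c)       ≡⟨ x∙yz≈y∙xz (suc t) b c ⟩
    b * (suc t * c)       ≡⟨ cong (b *_) ([k+1]*[n+1]C[k+1]≡[n+1]*nCk t j) ⟨
    b * (suc j * a)       ≡⟨ x∙yz≈y∙xz b (suc j) a ⟩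
    suc j * (b * a)       ≡⟨ cong (suc j *_) (*-comm b a) ⟩
    suc j * (a * b)       ∎)

-- Lists and rotations

module _ {a} {A : Set a} where

  take-++ˡ : ∀ {n} (xs ys : List A) → n ≤ length xs → take n (xs ++ ys) ≡ take n xs
  take-++ˡ []       ys z≤n       = refl
  take-++ˡ (x ∷ xs) ys z≤n       = refl
  take-++ˡ (x ∷ xs) ys (s≤s n≤m) = cong (x ∷_) (take-++ˡ xs ys n≤m)

  take-++ʳ : ∀ n (xs ys : List A) → take (length xs + n) (xs ++ ys) ≡ xs ++ take n ys
  take-++ʳ n []       ys = refl
  take-++ʳ n (x ∷ xs) ys = cong (x ∷_) (take-++ʳ n xs ys)

  drop-++ˡ : ∀ {n} (xs ys : List A) → n ≤ length xs → drop n (xs ++ ys) ≡ drop n xs ++ ys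
  drop-++ˡ []       ys z≤n       = refl
  drop-++ˡ (x ∷ xs) ys z≤n       = refl
  drop-++ˡ (x ∷ xs) ys (s≤s n≤m) = drop-++ˡ xs ys n≤m

  take-+ : ∀ m n (xs : List A) → take (m + n) xs ≡ take m xs ++ take n (drop m xs)
  take-+ zero    n xs       = refl
  take-+ (suc m) n []       = sym (take-[] n)
  take-+ (suc m) n (x ∷ xs) = cong (x ∷_) (take-+ m n xs)

  take-length-++ : (xs ys : List A) → take (length xs) (xs ++ ys) ≡ xs
  take-length-++ xs ys = trans (take-++ˡ xs ys ≤-refl) (take-all (length xs) xs ≤-refl)

  take-++-take : ∀ {d j} (ys xs : List A) → j ≤ length ys + d →
                 take j (ys ++ take d xs) ≡ take j (ys ++ xs)
  take-++-take {d} {j} []       xs j≤d =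
    trans (take-take j d xs) (cong (λ n → take n xs) (m≤n⇒m⊓n≡m j≤d))
  take-++-take {j = zero}  (y ∷ ys) xs _          = refl
  take-++-take {j = suc j} (y ∷ ys) xs (s≤s j≤n) = cong (y ∷_) (take-++-take ys xs j≤n)

  take-rotation : ∀ {d j} (xs : List A) → d ≤ length xs → j ≤ length xs →
                  take (d + j) (xs ++ xs) ≡ take d xs ++ take j (drop d xs ++ take d xs)
  take-rotation {d} {j} xs d≤n j≤n = begin
    take (d + j) (xs ++ xs)
      ≡⟨ take-+ d j (xs ++ xs) ⟩
    take d (xs ++ xs) ++ take j (drop d (xs ++ xs))
      ≡⟨ cong₂ (λ ys zs → ys ++ take j zs) (take-++ˡ xs xs d≤n) (drop-++ˡ xs xs d≤n) ⟩
    take d xs ++ take j (drop d xs ++ xs)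
      ≡⟨ cong (take d xs ++_) (take-++-take (drop d xs) xs j≤|drop|+d) ⟨
    take d xs ++ take j (drop d xs ++ take d xs)
      ∎
    where
    open ≡-Reasoning
    j≤|drop|+d : j ≤ length (drop d xs) + d
    j≤|drop|+d = subst (j ≤_) (sym (trans (cong (_+ d) (length-drop d xs)) (m∸n+n≡m d≤n))) j≤n

module _ {a p} {A : Set a} {P : Pred A p} where

  All-∷ʳ : ∀ {k x} {xs : Vec A k} → All P xs → P x → All P (xs ∷ʳ x)
  All-∷ʳ []         px = px ∷ []
  All-∷ʳ (py ∷ pxs) px = py ∷ All-∷ʳ pxs px

  count-∷ʳ : ∀ {k} (P? : Decidable P) (xs : Vec A k) x → count P? (xs ∷ʳ x) ≡ count P? (x ∷ xs)
  count-∷ʳ P? []       x = refl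
  count-∷ʳ P? (y ∷ xs) x with does (P? y) | does (P? x) | count-∷ʳ P? xs x
  ... | true  | true  | ih = cong suc ih
  ... | true  | false | ih = cong suc ih
  ... | false | _     | ih = ih

sum-∷ʳ : ∀ {k} (xs : Vec ℕ k) x → Vec.sum (xs ∷ʳ x) ≡ x + Vec.sum xs
sum-∷ʳ []       x = refl
sum-∷ʳ (y ∷ xs) x = trans (cong (y +_) (sum-∷ʳ xs x)) (+-exchange y x (Vec.sum xs))
  where
  +-exchange : ∀ a b c → a + (b + c) ≡ b + (a + c)
  +-exchange = solve-∀

rotateN-sucʳ : ∀ {k} d (v : Vec ℕ k) → rotateN (suc d) v ≡ rotateN d (rotate v)
rotateN-sucʳ zero    v = refl
rotateN-sucʳ (suc d) v = cong rotate (rotateN-sucʳ d v)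

rotateN-+ : ∀ {k} a b (v : Vec ℕ k) → rotateN (a + b) v ≡ rotateN a (rotateN b v)
rotateN-+ zero    b v = refl
rotateN-+ (suc a) b v = cong rotate (rotateN-+ a b v)

toList-rotateN : ∀ {k} d (v : Vec ℕ k) → d ≤ k →
                 toList (rotateN d v) ≡ drop d (toList v) ++ take d (toList v)
toList-rotateN zero    v        _         = sym (++-identityʳ (toList v))
toList-rotateN (suc d) (x ∷ xs) (s≤s d≤k) = begin
  toList (rotateN (suc d) (x ∷ xs))                  ≡⟨ cong toList (rotateN-sucʳ d (x ∷ xs)) ⟩
  toList (rotateN d (xs ∷ʳ x))                       ≡⟨ toList-rotateN d (xs ∷ʳ x) (m≤n⇒m≤1+n d≤k) ⟩
  drop d (toList (xs ∷ʳ x)) ++ take d (toList (xs ∷ʳ x))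
    ≡⟨ cong (λ zs → drop d zs ++ take d zs) (toList-∷ʳ x xs) ⟩
  drop d (ys ++ [ x ]) ++ take d (ys ++ [ x ])
    ≡⟨ cong₂ _++_ (drop-++ˡ ys [ x ] d≤|ys|) (take-++ˡ ys [ x ] d≤|ys|) ⟩
  (drop d ys ++ [ x ]) ++ take d ys                  ≡⟨ ++-assoc (drop d ys) [ x ] (take d ys) ⟩
  drop d ys ++ x ∷ take d ys                         ∎
  where
  open ≡-Reasoning
  ys : List ℕ
  ys = toList xs
  d≤|ys| : d ≤ length ys
  d≤|ys| = subst (d ≤_) (sym (length-toList xs)) d≤k

rotateN-length : ∀ {k} (v : Vec ℕ k) → rotateN k v ≡ v
rotateN-length {k} v =
  trans (sym (cast-is-id refl (rotateN k v))) (toList-injective refl (rotateN k v) v (begin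
    toList (rotateN k v)   ≡⟨ toList-rotateN k v ≤-refl ⟩
    drop k xs ++ take k xs ≡⟨ cong₂ _++_ (drop-all k xs k≥|xs|) (take-all k xs k≥|xs|) ⟩
    xs                     ∎))
  where
  open ≡-Reasoning
  xs : List ℕ
  xs = toList v
  k≥|xs| : k ≥ length xs
  k≥|xs| = ≤-reflexive (length-toList v)

rotateN-* : ∀ {k} q (v : Vec ℕ k) → rotateN (q * k) v ≡ v
rotateN-* zero        v = refl
rotateN-* {k} (suc q) v = begin
  rotateN (k + q * k) v        ≡⟨ rotateN-+ k (q * k) v ⟩
  rotateN k (rotateN (q * k) v) ≡⟨ cong (rotateN k) (rotateN-* q v) ⟩
  rotateN k v                  ≡⟨ rotateN-length v ⟩
  v                            ∎
  where open ≡-Reasoning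

rotateN-% : ∀ {k} i (v : Vec ℕ (suc k)) → rotateN (i % suc k) v ≡ rotateN i v
rotateN-% {k} i v = begin
  rotateN r v                   ≡⟨ cong (rotateN r) (rotateN-* q v) ⟨
  rotateN r (rotateN (q * n) v) ≡⟨ rotateN-+ r (q * n) v ⟨
  rotateN (r + q * n) v         ≡⟨ cong (λ i → rotateN i v) (m≡m%n+[m/n]*n i n) ⟨
  rotateN i v                   ∎
  where
  open ≡-Reasoning
  n : ℕ
  n = suc k
  q : ℕ
  q = i / n
  r : ℕ
  r = i % n

rotateN-∸ : ∀ {k d} (v : Vec ℕ k) → d ≤ k → rotateN (k ∸ d) (rotateN d v) ≡ v
rotateN-∸ {k} {d} v d≤k = begin
  rotateN (k ∸ d) (rotateN d v) ≡⟨ rotateN-+ (k ∸ d) d v ⟨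
  rotateN (k ∸ d + d) v         ≡⟨ cong (λ n → rotateN n v) (m∸n+n≡m d≤k) ⟩
  rotateN k v                   ≡⟨ rotateN-length v ⟩
  v                             ∎
  where open ≡-Reasoning

CycEquiv-trans : ∀ {k} {u v w : Vec ℕ k} → CycEquiv u v → CycEquiv v w → CycEquiv u w
CycEquiv-trans {u = u} (i , refl) (j , refl) = j + i , rotateN-+ j i u

CycEquiv⇒rotateN< : ∀ {k} {v w : Vec ℕ (suc k)} → CycEquiv v w → ∃[ r ] r < suc k × rotateN r v ≡ w
CycEquiv⇒rotateN< {k} {v} (i , eq) = i % suc k , m%n<n i (suc k) , trans (rotateN-% i v) eq

CycEquiv-sym : ∀ {k} {v w : Vec ℕ (suc k)} → CycEquiv v w → CycEquiv w v
CycEquiv-sym {k} {v} c with CycEquiv⇒rotateN< c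
... | r , r<k , refl = suc k ∸ r , rotateN-∸ v (<⇒≤ r<k)

Good-rotate : ∀ {k m} (v : Vec ℕ k) → Good k m v → Good k m (rotate v)
Good-rotate []       g                              = g
Good-rotate (x ∷ xs) ((x≥1 ∷ xs≥1 , Σv) , #big) =
  (All-∷ʳ xs≥1 x≥1 , trans (sum-∷ʳ xs x) Σv) , trans (count-∷ʳ (2 ≤?_) xs x) #big

Good-rotateN : ∀ {k m} d (v : Vec ℕ k) → Good k m v → Good k m (rotateN d v)
Good-rotateN zero    v g = g
Good-rotateN (suc d) v g = Good-rotate (rotateN d v) (Good-rotateN d v g)

-- The cycle lemma

Dominating : ∀ {k} → Vec ℕ k → Set
Dominating {k} v = ∀ {j} → j < k → 2 * j ≤ sum (take j (toList v))

dominating? : ∀ {k} → Decidable (Dominating {k})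
dominating? {k} v = allUpTo? (λ j → 2 * j ≤? sum (take j (toList v))) k

sum-take-rotateN : ∀ {k d j} (v : Vec ℕ k) → d ≤ k → j ≤ k →
                   sum (take d (toList v)) + sum (take j (toList (rotateN d v)))
                   ≡ sum (take (d + j) (toList v ++ toList v))
sum-take-rotateN {k} {d} {j} v d≤k j≤k = begin
  sum (take d xs) + sum (take j (toList (rotateN d v)))
    ≡⟨ cong (λ ys → sum (take d xs) + sum (take j ys)) (toList-rotateN d v d≤k) ⟩
  sum (take d xs) + sum (take j (drop d xs ++ take d xs))
    ≡⟨ sum-++ (take d xs) _ ⟨
  sum (take d xs ++ take j (drop d xs ++ take d xs))
    ≡⟨ cong sum (take-rotation xs (≤-len d≤k) (≤-len j≤k)) ⟨
  sum (take (d + j) (xs ++ xs))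
    ∎
  where
  open ≡-Reasoning
  xs : List ℕ
  xs = toList v
  ≤-len : ∀ {i} → i ≤ k → i ≤ length xs
  ≤-len = subst (_ ≤_) (sym (length-toList v))

dominating-rotateN⇒≡0 : ∀ {k d} (v : Vec ℕ k) → suc (sum (toList v)) ≡ 2 * k → d < k →
                        Dominating v → Dominating (rotateN d v) → d ≡ 0
dominating-rotateN⇒≡0 {d = zero}      _ _     _   _     _     = refl
dominating-rotateN⇒≡0 {k} {d = suc c} v total d<k dom-v dom-r =
  contradiction (sym total) (<⇒≢ (s≤s 2k≤sum))
  where
  d : ℕ
  d = suc c
  xs : List ℕ
  xs = toList v
  d+[k∸d]≡|xs| : d + (k ∸ d) ≡ length xs
  d+[k∸d]≡|xs| = trans (m+[n∸m]≡n (<⇒≤ d<k)) (sym (length-toList v))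
  2k≤sum : 2 * k ≤ sum xs
  2k≤sum = begin
    2 * k
      ≡⟨ cong (2 *_) (m+[n∸m]≡n (<⇒≤ d<k)) ⟨
    2 * (d + (k ∸ d))
      ≡⟨ *-distribˡ-+ 2 d (k ∸ d) ⟩
    2 * d + 2 * (k ∸ d)
      ≤⟨ +-mono-≤ (dom-v d<k) (dom-r (∸-monoʳ-< {k} z<s (<⇒≤ d<k))) ⟩
    sum (take d xs) + sum (take (k ∸ d) (toList (rotateN d v)))
      ≡⟨ sum-take-rotateN v (<⇒≤ d<k) (m∸n≤m k d) ⟩
    sum (take (d + (k ∸ d)) (xs ++ xs))
      ≡⟨ cong (λ n → sum (take n (xs ++ xs))) d+[k∸d]≡|xs| ⟩
    sum (take (length xs) (xs ++ xs))
      ≡⟨ cong sum (take-length-++ xs xs) ⟩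
    sum xs
      ∎
    where open ≤-Reasoning

dominating-unique : ∀ {k} {v w : Vec ℕ (suc k)} → suc (sum (toList v)) ≡ 2 * suc k →
                    Dominating v → Dominating w → CycEquiv v w → v ≡ w
dominating-unique {v = v} total dom-v dom-w c with CycEquiv⇒rotateN< c
... | r , r<k , refl with dominating-rotateN⇒≡0 v total r<k dom-v dom-w
...   | refl = refl

first-argmin : (f : ℕ → ℕ) (n : ℕ) →
  ∃[ d ] d ≤ n × (∀ {i} → i < d → f d < f i) × (∀ {i} → i ≤ n → f d ≤ f i)
first-argmin f zero = 0 , z≤n , (λ ()) , λ { z≤n → ≤-refl }
first-argmin f (suc n) with first-argmin f n
... | d , d≤n , first , least with f (suc n) <? f d
...   | yes fn<fd = suc n , ≤-refl , (λ i<sn → <-≤-trans fn<fd (least (s≤s⁻¹ i<sn))) , least′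
  where
  least′ : ∀ {i} → i ≤ suc n → f (suc n) ≤ f i
  least′ i≤sn with m≤n⇒m<n∨m≡n i≤sn
  ... | inj₁ i<sn = <⇒≤ (<-≤-trans fn<fd (least (s≤s⁻¹ i<sn)))
  ... | inj₂ refl = ≤-refl
...   | no fn≮fd = d , m≤n⇒m≤1+n d≤n , first , least′
  where
  least′ : ∀ {i} → i ≤ suc n → f d ≤ f i
  least′ i≤sn with m≤n⇒m<n∨m≡n i≤sn
  ... | inj₁ i<sn = least (s≤s⁻¹ i<sn)
  ... | inj₂ refl = ≮⇒≥ fn≮fd

∸-rise : ∀ {N i j} a b → i + j ≤ N → a + 2 * (N ∸ i) ≤ b + 2 * (N ∸ (i + j)) → a + 2 * j ≤ b
∸-rise {N} {i} {j} a b i+j≤N h = +-cancelʳ-≤ (2 * r) (a + 2 * j) b (subst (_≤ b + 2 * r) eq h)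
  where
  r : ℕ
  r = N ∸ (i + j)
  regroup : ∀ a j r → a + 2 * (j + r) ≡ a + 2 * j + 2 * r
  regroup = solve-∀
  eq : a + 2 * (N ∸ i) ≡ a + 2 * j + 2 * r
  eq = trans (cong (λ x → a + 2 * x) (begin
    N ∸ i             ≡⟨ cong (_∸ i) (m+[n∸m]≡n i+j≤N) ⟨
    i + j + r ∸ i     ≡⟨ cong (_∸ i) (+-assoc i j r) ⟩
    i + (j + r) ∸ i   ≡⟨ m+n∸m≡n i (j + r) ⟩
    j + r             ∎)) (regroup a j r)
    where open ≡-Reasoning

module _ {k} (v : Vec ℕ (suc k)) (total : suc (sum (toList v)) ≡ 2 * suc k) where

  private
    n : ℕ
    n = suc k

    xs : List ℕ
    xs = toList v

    ≤-len : ∀ {i} → i ≤ n → i ≤ length xs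
    ≤-len = subst (_ ≤_) (sym (length-toList v))

    T : ℕ → ℕ
    T i = sum (take i (xs ++ xs))

    -- T i − 2 i, shifted up by 4n so that it stays in ℕ for i ≤ 2n
    level : ℕ → ℕ
    level i = T i + 2 * (2 * n ∸ i)

    T-≤ : ∀ {i} → i ≤ n → T i ≡ sum (take i xs)
    T-≤ i≤n = cong sum (take-++ˡ xs xs (≤-len i≤n))

    T-n+ : ∀ {i} → i ≤ n → T (n + i) ≡ sum xs + T i
    T-n+ {i} i≤n = begin
      T (n + i)                             ≡⟨ cong (λ m → sum (take (m + i) (xs ++ xs))) (length-toList v) ⟨
      sum (take (length xs + i) (xs ++ xs)) ≡⟨ cong sum (take-++ʳ i xs xs) ⟩
      sum (xs ++ take i xs)                 ≡⟨ sum-++ xs (take i xs) ⟩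
      sum xs + sum (take i xs)              ≡⟨ cong (sum xs +_) (T-≤ i≤n) ⟨
      sum xs + T i                          ∎
      where open ≡-Reasoning

    level-period : ∀ {i} → i ≤ n → suc (level (n + i)) ≡ level i
    level-period {i} i≤n = begin
      suc (T (n + i) + 2 * r)    ≡⟨ cong (λ t → suc (t + 2 * r)) (T-n+ i≤n) ⟩
      suc (sum xs + T i + 2 * r) ≡⟨ cong (λ s → s + T i + 2 * r) total ⟩
      2 * n + T i + 2 * r        ≡⟨ regroup n (T i) r ⟩
      T i + 2 * (n + r)          ≡⟨ cong (λ m → T i + 2 * m) 2n∸i≡n+r ⟨
      T i + 2 * (2 * n ∸ i)      ∎
      where
      open ≡-Reasoning
      r : ℕ
      r = 2 * n ∸ (n + i)
      regroup : ∀ n t r → 2 * n + t + 2 * r ≡ t + 2 * (n + r)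
      regroup = solve-∀
      2n∸i≡n+r : 2 * n ∸ i ≡ n + r
      2n∸i≡n+r = trans (+-∸-assoc n (≤-trans i≤n (m≤m+n n 0)))
                       (cong (n +_) (sym ([m+n]∸[m+o]≡n∸o n (n + 0) i)))

    -- Past the first period the walk is one lower than at i − n, where it is strictly above level d.
    first-minimum-on-window : ∀ {d i} → d ≤ k → (∀ {i} → i < d → level d < level i) →
                              (∀ {i} → i ≤ k → level d ≤ level i) → i < d + n → level d ≤ level i
    first-minimum-on-window {d} {i} d≤k below least i<d+n with i ≤? k
    ... | yes i≤k = least i≤k
    ... | no  i≰k = subst (λ m → level d ≤ level m) (m+[n∸m]≡n n≤i) (s≤s⁻¹ (begin-strict
      level d                   <⟨ below i∸n<d ⟩
      level (i ∸ n)             ≡⟨ level-period (<⇒≤ (<-≤-trans i∸n<d (m≤n⇒m≤1+n d≤k))) ⟨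
      suc (level (n + (i ∸ n))) ∎))
      where
      open ≤-Reasoning
      n≤i : n ≤ i
      n≤i = ≰⇒> i≰k
      i∸n<d : i ∸ n < d
      i∸n<d = +-cancelˡ-< n (i ∸ n) d (subst₂ _<_ (sym (m+[n∸m]≡n n≤i)) (+-comm d n) i<d+n)

    minimum-on-window⇒dominating : ∀ {d} → d ≤ n → (∀ {i} → i < d + n → level d ≤ level i) →
                                   Dominating (rotateN d v)
    minimum-on-window⇒dominating {d} d≤n least {j} j<n = +-cancelˡ-≤ (sum (take d xs)) _ _ (begin
      sum (take d xs) + 2 * j                               ≡⟨ cong (_+ 2 * j) (T-≤ d≤n) ⟨
      T d + 2 * j                                           ≤⟨ rise ⟩
      T (d + j)                                             ≡⟨ sum-take-rotateN v d≤n (<⇒≤ j<n) ⟨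
      sum (take d xs) + sum (take j (toList (rotateN d v))) ∎)
      where
      open ≤-Reasoning
      d+j≤2n : d + j ≤ 2 * n
      d+j≤2n = +-mono-≤ d≤n (≤-trans (<⇒≤ j<n) (m≤m+n n 0))
      rise : T d + 2 * j ≤ T (d + j)
      rise = ∸-rise {2 * n} {d} {j} (T d) (T (d + j)) d+j≤2n (least (+-monoʳ-< d j<n))

  ∃-dominating-rotateN : ∃[ d ] d < suc k × Dominating (rotateN d v)
  ∃-dominating-rotateN with first-argmin level k
  ... | d , d≤k , below , least =
    d , s≤s d≤k , minimum-on-window⇒dominating (m≤n⇒m≤1+n d≤k) (first-minimum-on-window d≤k below least)

-- Enumerating compositions by their number of large parts

incrementHead : ∀ {k} → Vec ℕ (suc k) → Vec ℕ (suc k)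
incrementHead (x ∷ xs) = suc x ∷ xs

-- A composition of k + s into k parts begins with 1, with 2, or with a part ≥ 3 obtained by
-- incrementing the head of a composition of excess s − 1; this is the recursion of compositionCount.
compositions   : (s k j : ℕ) → List (Vec ℕ k)
compositions≥2 : (s k j : ℕ) → List (Vec ℕ (suc k))
compositions s       (suc k) j       = map (1 ∷_) (compositions s k j) ++ compositions≥2 s k j
compositions zero    zero    zero    = [ [] ]
compositions zero    zero    (suc j) = []
compositions (suc s) zero    j       = []
compositions≥2 s       k zero    = []
compositions≥2 zero    k (suc j) = []
compositions≥2 (suc s) k (suc j) =
  map (2 ∷_) (compositions s k j) ++ map incrementHead (compositions≥2 s k (suc j))

compositions-sound : ∀ s k j {v} → v ∈ compositions s k j →
                     IsComposition (k + s) k v × bigParts v ≡ j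
compositions≥2-sound : ∀ s k j {v} → v ∈ compositions≥2 s k j →
                       (IsComposition (suc k + s) (suc k) v × bigParts v ≡ j) × 2 ≤ Vec.head v
compositions-sound zero zero zero (here refl) = ([] , refl) , refl
compositions-sound s (suc k) j v∈ with ∈-++⁻ (map (1 ∷_) (compositions s k j)) v∈
... | inj₂ v∈≥2 = proj₁ (compositions≥2-sound s k j v∈≥2)
... | inj₁ v∈1 with ∈-map⁻ (1 ∷_) v∈1
...   | w , w∈ , refl with compositions-sound s k j w∈
...     | (w≥1 , Σw) , #big = (s≤s z≤n ∷ w≥1 , cong suc Σw) , #big
compositions≥2-sound (suc s) k (suc j) v∈ with ∈-++⁻ (map (2 ∷_) (compositions s k j)) v∈
... | inj₁ v∈2 with ∈-map⁻ (2 ∷_) v∈2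
...   | w , w∈ , refl with compositions-sound s k j w∈
...     | (w≥1 , Σw) , #big =
  ((s≤s z≤n ∷ w≥1 , trans (cong (2 +_) Σw) (cong suc (sym (+-suc k s)))) , cong suc #big) , s≤s (s≤s z≤n)
compositions≥2-sound (suc s) k (suc j) v∈ | inj₂ v∈inc with ∈-map⁻ incrementHead v∈inc
... | (y ∷ ys) , w∈ , refl with compositions≥2-sound s k (suc j) w∈
...   | ((_ ∷ ys≥1 , Σw) , #big) , s≤s (s≤s _) =
  ((s≤s z≤n ∷ ys≥1 , cong suc (trans Σw (sym (+-suc k s)))) , #big) , s≤s (s≤s z≤n)

length≤sum : ∀ {k} {v : Vec ℕ k} → All (1 ≤_) v → k ≤ Vec.sum v
length≤sum []           = z≤n
length≤sum (x≥1 ∷ v≥1) = +-mono-≤ x≥1 (length≤sum v≥1)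

compositions-complete : ∀ s k j (v : Vec ℕ k) → IsComposition (k + s) k v → bigParts v ≡ j →
                        v ∈ compositions s k j
compositions≥2-complete : ∀ s k j (v : Vec ℕ (suc k)) → 2 ≤ Vec.head v →
                          IsComposition (suc k + s) (suc k) v → bigParts v ≡ j → v ∈ compositions≥2 s k j
compositions-complete zero    zero    zero    [] _        _  = here refl
compositions-complete zero    zero    (suc j) [] _        ()
compositions-complete (suc s) zero    j       [] (_ , ()) _
compositions-complete s (suc k) j (1 ∷ xs) (_ ∷ xs≥1 , Σv) #big =
  ∈-++⁺ˡ (∈-map⁺ (1 ∷_) (compositions-complete s k j xs (xs≥1 , suc-injective Σv) #big))
compositions-complete s (suc k) j v@(suc (suc _) ∷ _) c #big =
  ∈-++⁺ʳ (map (1 ∷_) (compositions s k j)) (compositions≥2-complete s k j v (s≤s (s≤s z≤n)) c #big)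
compositions≥2-complete s k j (1 ∷ xs) (s≤s ()) _ _
compositions≥2-complete zero k j (suc (suc y) ∷ xs) _ (_ ∷ xs≥1 , Σv) _ =
  contradiction (trans Σv (+-identityʳ (suc k))) (>⇒≢ (s≤s (s≤s (≤-trans (length≤sum xs≥1) (m≤n+m _ y)))))
compositions≥2-complete (suc s) k (suc j) (2 ∷ xs) _ (_ ∷ xs≥1 , Σv) #big =
  ∈-++⁺ˡ (∈-map⁺ (2 ∷_) (compositions-complete s k j xs (xs≥1 , Σxs) (suc-injective #big)))
  where
  Σxs : Vec.sum xs ≡ k + s
  Σxs = suc-injective (trans (suc-injective Σv) (+-suc k s))
compositions≥2-complete (suc s) k (suc j) (suc (suc (suc y)) ∷ xs) _ (_ ∷ xs≥1 , Σv) #big =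
  ∈-++⁺ʳ (map (2 ∷_) (compositions s k j)) (∈-map⁺ incrementHead
    (compositions≥2-complete s k (suc j) (suc (suc y) ∷ xs) (s≤s (s≤s z≤n)) (s≤s z≤n ∷ xs≥1 , Σv′) #big))
  where
  Σv′ : Vec.sum (suc (suc y) ∷ xs) ≡ suc k + s
  Σv′ = suc-injective (trans Σv (cong suc (+-suc k s)))

incrementHead-injective : ∀ {k} {v w : Vec ℕ (suc k)} → incrementHead v ≡ incrementHead w → v ≡ w
incrementHead-injective {v = _ ∷ _} {_ ∷ _} refl = refl

compositions-unique   : ∀ s k j → Unique (compositions s k j)
compositions≥2-unique : ∀ s k j → Unique (compositions≥2 s k j)
compositions-unique zero    zero    zero    = [] ∷ []
compositions-unique zero    zero    (suc j) = []
compositions-unique (suc s) zero    j       = []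
compositions-unique s       (suc k) j       =
  Unique.++⁺ (Unique.map⁺ ∷-injectiveʳ (compositions-unique s k j)) (compositions≥2-unique s k j) disjoint
  where
  disjoint : Disjoint (map (1 ∷_) (compositions s k j)) (compositions≥2 s k j)
  disjoint (v∈1 , v∈≥2) with ∈-map⁻ (1 ∷_) v∈1
  ... | _ , _ , refl with compositions≥2-sound s k j v∈≥2
  ...   | _ , s≤s ()
compositions≥2-unique s       k zero    = []
compositions≥2-unique zero    k (suc j) = []
compositions≥2-unique (suc s) k (suc j) =
  Unique.++⁺ (Unique.map⁺ ∷-injectiveʳ (compositions-unique s k j))
             (Unique.map⁺ incrementHead-injective (compositions≥2-unique s k (suc j))) disjoint
  where
  disjoint : Disjoint (map (2 ∷_) (compositions s k j)) (map incrementHead (compositions≥2 s k (suc j)))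
  disjoint (v∈2 , v∈inc) with ∈-map⁻ (2 ∷_) v∈2 | ∈-map⁻ incrementHead v∈inc
  ... | _ , _ , refl | (_ ∷ _) , w∈ , eq with compositions≥2-sound s k (suc j) w∈
  ...   | _ , s≤s (s≤s _) with eq
  ...     | ()

length-compositions   : ∀ s k j → length (compositions s k j) ≡ (k C j) * compositionCount s j
length-compositions≥2 : ∀ s k j → length (compositions≥2 s k (suc j)) ≡ (k C j) * compositionCount s (suc j)
length-compositions zero    zero    zero    = refl
length-compositions zero    zero    (suc j) = refl
length-compositions (suc s) zero    zero    = refl
length-compositions (suc s) zero    (suc j) = refl
length-compositions s       (suc k) zero    = begin
  length (map (1 ∷_) (compositions s k 0) ++ [])   ≡⟨ length-++ (map (1 ∷_) (compositions s k 0)) ⟩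
  length (map (1 ∷_) (compositions s k 0)) + 0     ≡⟨ +-identityʳ _ ⟩
  length (map (1 ∷_) (compositions s k 0))         ≡⟨ length-map (1 ∷_) (compositions s k 0) ⟩
  length (compositions s k 0)                      ≡⟨ length-compositions s k 0 ⟩
  1 * compositionCount s 0                         ∎
  where open ≡-Reasoning
length-compositions s       (suc k) (suc j) = begin
  length (map (1 ∷_) (compositions s k (suc j)) ++ compositions≥2 s k (suc j))
    ≡⟨ length-++ (map (1 ∷_) (compositions s k (suc j))) ⟩
  length (map (1 ∷_) (compositions s k (suc j))) + length (compositions≥2 s k (suc j))
    ≡⟨ cong₂ _+_ (trans (length-map (1 ∷_) (compositions s k (suc j))) (length-compositions s k (suc j)))
                 (length-compositions≥2 s k j) ⟩
  (k C suc j) * D + (k C j) * D ≡⟨ *-distribʳ-+ D (k C suc j) (k C j) ⟨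
  (k C suc j + k C j) * D       ≡⟨ cong (_* D) (+-comm (k C suc j) (k C j)) ⟩
  (k C j + k C suc j) * D       ≡⟨ cong (_* D) (nCk+nC[k+1]≡[n+1]C[k+1] k j) ⟩
  (suc k C suc j) * D           ∎
  where
  open ≡-Reasoning
  D : ℕ
  D = compositionCount s (suc j)
length-compositions≥2 zero    k j = sym (*-zeroʳ (k C j))
length-compositions≥2 (suc s) k j = begin
  length (map (2 ∷_) (compositions s k j) ++ map incrementHead (compositions≥2 s k (suc j)))
    ≡⟨ length-++ (map (2 ∷_) (compositions s k j)) ⟩
  length (map (2 ∷_) (compositions s k j)) + length (map incrementHead (compositions≥2 s k (suc j)))
    ≡⟨ cong₂ _+_ (trans (length-map (2 ∷_) (compositions s k j)) (length-compositions s k j))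
                 (trans (length-map incrementHead (compositions≥2 s k (suc j))) (length-compositions≥2 s k j)) ⟩
  (k C j) * compositionCount s j + (k C j) * compositionCount s (suc j)
    ≡⟨ *-distribˡ-+ (k C j) (compositionCount s j) (compositionCount s (suc j)) ⟨
  (k C j) * compositionCount (suc s) (suc j) ∎
  where open ≡-Reasoning

-- Counting cyclic classes

orbit : ∀ {k} → Vec ℕ k → List (Vec ℕ k)
orbit {k} v = applyUpTo (λ d → rotateN d v) k

∈-orbit⁻ : ∀ {k} {v w : Vec ℕ k} → w ∈ orbit v → CycEquiv v w
∈-orbit⁻ {v = v} w∈ with ∈-applyUpTo⁻ (λ d → rotateN d v) w∈
... | d , _ , eq = d , sym eq

orbit-unique : ∀ {k} {v : Vec ℕ (suc k)} → suc (sum (toList v)) ≡ 2 * suc k → Dominating v →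
               Unique (orbit v)
orbit-unique {k} {v} total dom-v = Unique.applyUpTo⁺₁ (λ d → rotateN d v) (suc k) distinct
  where
  distinct : ∀ {i j} → i < j → j < suc k → rotateN i v ≢ rotateN j v
  distinct {i} {j} i<j j<n eq =
    0<r (dominating-rotateN⇒≡0 v total r<n dom-v (subst Dominating (sym rotateN-r≡v) dom-v))
    where
    r : ℕ
    r = suc k ∸ j + i
    0<r : r ≢ 0
    0<r = m<n⇒n≢0 (≤-trans (m<n⇒0<n∸m j<n) (m≤m+n (suc k ∸ j) i))
    r<n : r < suc k
    r<n = subst (r <_) (m∸n+n≡m (<⇒≤ j<n)) (+-monoʳ-< (suc k ∸ j) i<j)
    rotateN-r≡v : rotateN r v ≡ v
    rotateN-r≡v = begin
      rotateN r v                       ≡⟨ rotateN-+ (suc k ∸ j) i v ⟩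
      rotateN (suc k ∸ j) (rotateN i v) ≡⟨ cong (rotateN (suc k ∸ j)) eq ⟩
      rotateN (suc k ∸ j) (rotateN j v) ≡⟨ rotateN-∸ v (<⇒≤ j<n) ⟩
      v                                 ∎
      where open ≡-Reasoning

orbits-disjoint : ∀ {k} {v w : Vec ℕ (suc k)} → ¬ CycEquiv v w → Disjoint (orbit v) (orbit w)
orbits-disjoint v≁w (u∈v , u∈w) = v≁w (CycEquiv-trans (∈-orbit⁻ u∈v) (CycEquiv-sym (∈-orbit⁻ u∈w)))

length-orbits : ∀ {k} (vs : List (Vec ℕ k)) → length (concatMap orbit vs) ≡ k * length vs
length-orbits {k} []       = sym (*-zeroʳ k)
length-orbits {k} (v ∷ vs) = begin
  length (orbit v ++ concatMap orbit vs)
    ≡⟨ length-++ (orbit v) ⟩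
  length (orbit v) + length (concatMap orbit vs)
    ≡⟨ cong₂ _+_ (length-applyUpTo (λ d → rotateN d v) k) (length-orbits vs) ⟩
  k + k * length vs
    ≡⟨ *-suc k (length vs) ⟨
  k * suc (length vs)
    ∎
  where open ≡-Reasoning

AllPairs-¬ : ∀ {a p r} {A : Set a} {P : Pred A p} {R : A → A → Set r} {xs : List A} →
             (∀ {x y} → P x → P y → R x y → x ≡ y) →
             ListAll.All P xs → Unique xs → AllPairs (λ x y → ¬ R x y) xs
AllPairs-¬ R⇒≡ []         []           = []
AllPairs-¬ R⇒≡ (px ∷ pxs) (x∉xs ∷ xs!) =
  ListAll.zipWith (λ (x≢y , py) → x≢y ∘ R⇒≡ px py) (x∉xs , pxs) ∷ AllPairs-¬ R⇒≡ pxs xs!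

module Representatives (k m : ℕ) where

  2[1+k]∸1≡[1+k]+k : 2 * suc k ∸ 1 ≡ suc k + k
  2[1+k]∸1≡[1+k]+k = regroup k
    where
    regroup : ∀ k → k + 1 * suc k ≡ suc k + k
    regroup = solve-∀

  good-compositions : List (Vec ℕ (suc k))
  good-compositions = compositions k (suc k) m

  ∈-good-compositions⁻ : ∀ {v} → v ∈ good-compositions → Good (suc k) m v
  ∈-good-compositions⁻ v∈ with compositions-sound k (suc k) m v∈
  ... | (v≥1 , Σv) , #big = (v≥1 , trans Σv (sym 2[1+k]∸1≡[1+k]+k)) , #big

  ∈-good-compositions⁺ : ∀ {v} → Good (suc k) m v → v ∈ good-compositions
  ∈-good-compositions⁺ {v} ((v≥1 , Σv) , #big) =
    compositions-complete k (suc k) m v (v≥1 , trans Σv 2[1+k]∸1≡[1+k]+k) #big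

  Good⇒total : ∀ {v} → Good (suc k) m v → suc (sum (toList v)) ≡ 2 * suc k
  Good⇒total {v} ((_ , Σv) , _) = cong suc (trans (sym (Vec-sum≡sum v)) Σv)
    where
    Vec-sum≡sum : ∀ {n} (w : Vec ℕ n) → Vec.sum w ≡ sum (toList w)
    Vec-sum≡sum []       = refl
    Vec-sum≡sum (x ∷ w) = cong (x +_) (Vec-sum≡sum w)

  reps : List (Vec ℕ (suc k))
  reps = filter dominating? good-compositions

  ∈-reps⁻ : ∀ {v} → v ∈ reps → Good (suc k) m v × Dominating v
  ∈-reps⁻ v∈ with ∈-filter⁻ dominating? {xs = good-compositions} v∈
  ... | v∈good , dom = ∈-good-compositions⁻ v∈good , dom

  reps-inequivalent : AllPairs (λ v w → ¬ CycEquiv v w) reps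
  reps-inequivalent =
    AllPairs-¬ (λ (g , dom-v) (_ , dom-w) → dominating-unique (Good⇒total g) dom-v dom-w)
               (ListAll.tabulate ∈-reps⁻)
               (Unique.filter⁺ dominating? (compositions-unique k (suc k) m))

  reps-cover : ∀ v → Good (suc k) m v → ∃[ w ] (w ∈ reps × CycEquiv v w)
  reps-cover v g with ∃-dominating-rotateN v (Good⇒total g)
  ... | d , _ , dom =
    rotateN d v , ∈-filter⁺ dominating? (∈-good-compositions⁺ (Good-rotateN d v g)) dom , d , refl

  orbits : List (Vec ℕ (suc k))
  orbits = concatMap orbit reps

  orbits-unique : Unique orbits
  orbits-unique = Unique.concat⁺
    (ListAll.map⁺ (ListAll.tabulate λ v∈ → let g , dom = ∈-reps⁻ v∈ in orbit-unique (Good⇒total g) dom))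
    (AllPairs.map⁺ (AllPairs.map orbits-disjoint reps-inequivalent))

  orbits⊆good-compositions : ∀ {v} → v ∈ orbits → v ∈ good-compositions
  orbits⊆good-compositions v∈ with find (∈-concatMap⁻ orbit {xs = reps} v∈)
  ... | w , w∈ , v∈orbit with ∈-orbit⁻ v∈orbit
  ...   | d , refl = ∈-good-compositions⁺ (Good-rotateN d w (proj₁ (∈-reps⁻ w∈)))

  good-compositions⊆orbits : ∀ {v} → v ∈ good-compositions → v ∈ orbits
  good-compositions⊆orbits {v} v∈ with reps-cover v (∈-good-compositions⁻ v∈)
  ... | w , w∈ , v~w with CycEquiv⇒rotateN< (CycEquiv-sym v~w)
  ...   | r , r<k , refl = ∈-concatMap⁺ orbit (lose w∈ (∈-applyUpTo⁺ (λ d → rotateN d w) r<k))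

  orbits↭good-compositions : orbits ↭ good-compositions
  orbits↭good-compositions = ∼bag⇒↭ (unique∧set⇒bag orbits-unique (compositions-unique k (suc k) m)
                                       (mk⇔ orbits⊆good-compositions good-compositions⊆orbits))

  length-reps : suc k * length reps ≡ (suc k C m) * compositionCount k m
  length-reps = begin
    suc k * length reps                ≡⟨ length-orbits reps ⟨
    length orbits                      ≡⟨ ↭-length orbits↭good-compositions ⟩
    length good-compositions           ≡⟨ length-compositions k (suc k) m ⟩
    (suc k C m) * compositionCount k m ∎
    where open ≡-Reasoning

lemma4p8 : (k m : ℕ) → 1 ≤ k → NumCyclicClasses k (Good k m) (narayana (k ∸ 1) m)
lemma4p8 (suc k) m _ =
  reps , ListAll.tabulate (proj₁ ∘ ∈-reps⁻) , reps-inequivalent , reps-cover ,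
  narayana-unique k m (length reps) length-reps
  where open Representatives k m
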